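{- Let $\lambda$ be a nonzero real number. For all integers $n\geq 0$ and $k\in\mathbb{Z}$, \[ E_{n,\lambda}^{(k)}(x)=\sum_{l=0}^{n}\sum_{m=0}^{l}\binom{n}{l}(x)_{m}\,S_{2,\lambda}(l,m)\,E_{n-l,\lambda}^{(k)}. \]
   Context: For nonzero $\lambda$, $e_\lambda^x(t)=(1+\lambda t)^{x/\lambda}$ and $e_\lambda(t)=(1+\lambda t)^{1/\lambda}$. Here $(x)_0=1$, $(x)_m=x(x-1)\cdots(x-m+1)$. The degenerate Stirling numbers of the second kind are defined by $\frac{1}{m!}(e_\lambda(t)-1)^m=\sum_{l=m}^{\infty}S_{2,\lambda}(l,m)\frac{t^l}{l!}$. The degenerate polylogarithm is $l_{k,\lambda}(x)=\sum_{n=1}^{\infty}\frac{(-\lambda)^{n-1}(1)_{n,1/\lambda}}{(n-1)!\,n^{k}}x^{n}$ for $k\in\mathbb{Z}$, where $(1)_{n,1/\lambda}=\prod_{i=0}^{n-1}(1-i/\lambda)$. The degenerate poly-Euler polynomials are defined by \[ \frac{l_{k,\lambda}\big(1-e_{\lambda}(-2t)\big)}{t(e_{\lambda}(t)+1)}e_{\lambda}^{x}(t)=\sum_{n=0}^{\infty}E_{n,\lambda}^{(k)}(x)\frac{t^{n}}{n!}, \] and $E_{n,\lambda}^{(k)}=E_{n,\lambda}^{(k)}(0)$.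
   Formalization: The parameter λ ranges over the nonzero rationals instead of the nonzero reals, and the variable x is taken over the rationals. -}

module Defs where

open import Data.Nat as ℕ using (ℕ; zero; suc; _∸_)
open import Data.Nat.Combinatorics using (_C_)
open import Data.Integer as ℤ using (ℤ; +_; -[1+_])
open import Data.Rational as ℚ using (ℚ; 0ℚ; 1ℚ; _+_; _*_; _-_; -_; 1/_; _/_; NonZero)

-- Formal power series in t over ℚ: the coefficient of t^n.
Series : Set
Series = ℕ → ℚ

ℕ→ℚ : ℕ → ℚ
ℕ→ℚ n = (+ n) / 1

sumTo : ℕ → (ℕ → ℚ) → ℚ
sumTo zero f = f 0
sumTo (suc n) f = sumTo n f + f (suc n)

sumFrom1To : ℕ → (ℕ → ℚ) → ℚ
sumFrom1To zero f = 0ℚ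
sumFrom1To (suc n) f = sumFrom1To n f + f (suc n)

_^ℚ_ : ℚ → ℕ → ℚ
a ^ℚ zero = 1ℚ
a ^ℚ suc n = (a ^ℚ n) * a

factℚ : ℕ → ℚ
factℚ zero = 1ℚ
factℚ (suc n) = factℚ n * ℕ→ℚ (suc n)

fallℚ : ℚ → ℕ → ℚ
fallℚ a zero = 1ℚ
fallℚ a (suc n) = fallℚ a n * (a - ℕ→ℚ n)

_⋆_ : Series → Series → Series
(f ⋆ g) n = sumTo n (λ i → f i * g (n ∸ i))

oneS : Series
oneS zero = 1ℚ
oneS (suc n) = 0ℚ

powS : Series → ℕ → Series
powS f zero = oneS
powS f (suc m) = f ⋆ powS f m

-- composition a(u(t)) = Σ_m a_m u(t)^m, for u with zero constant term
-- (then u^m contributes to t^N only for m ≤ N).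
compS : (ℕ → ℚ) → Series → Series
compS a u N = sumTo N (λ m → a m * powS u m N)

invFact : ℕ → ℚ
invFact zero = 1ℚ
invFact (suc n) = invFact n * ((+ 1) / suc n)

-- n^(-k) for n ≥ 1 and k ∈ ℤ, written invPowZ m k = (1+m)^(-k)
invPowNat : ℕ → ℕ → ℚ
invPowNat m zero = 1ℚ
invPowNat m (suc j) = invPowNat m j * ((+ 1) / suc m)

invPowZ : ℕ → ℤ → ℚ
invPowZ m (+ j) = invPowNat m j
invPowZ m -[1+ j ] = ℕ→ℚ (suc m) ^ℚ suc j

-- e_λ^x(t) = (1+λt)^{x/λ} = Σ_n binom(x/λ, n) λ^n t^n  (binomial series)
eλx : (λ' : ℚ) → .{{NonZero λ'}} → ℚ → Series
eλx λ' x n = fallℚ (x * (1/ λ')) n * (λ' ^ℚ n) * invFact n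

eλ : (λ' : ℚ) → .{{NonZero λ'}} → Series
eλ λ' = eλx λ' 1ℚ

genFall1 : (λ' : ℚ) → .{{NonZero λ'}} → ℕ → ℚ
genFall1 λ' zero = 1ℚ
genFall1 λ' (suc n) = genFall1 λ' n * (1ℚ - ℕ→ℚ n * (1/ λ'))

-- coefficients of the degenerate polylogarithm l_{k,λ}(x) = Σ_{n≥1} c_n x^n,
-- c_n = (-λ)^{n-1} (1)_{n,1/λ} / ((n-1)! n^k), c_0 = 0
polylogCoeff : (λ' : ℚ) → .{{NonZero λ'}} → ℤ → ℕ → ℚ
polylogCoeff λ' k zero = 0ℚ
polylogCoeff λ' k (suc m) =
  ((- λ') ^ℚ m) * genFall1 λ' (suc m) * invFact m * invPowZ m k

-- u(t) = 1 - e_λ(-2t)  (constant term 0)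
uSeries : (λ' : ℚ) → .{{NonZero λ'}} → Series
uSeries λ' zero = 1ℚ - eλ λ' 0
uSeries λ' (suc n) = - (eλ λ' (suc n) * ((- ℕ→ℚ 2) ^ℚ suc n))

polylogPart : (λ' : ℚ) → .{{NonZero λ'}} → ℤ → Series
polylogPart λ' k = compS (polylogCoeff λ' k) (uSeries λ')

-- divide a series with zero constant term by t
divT : Series → Series
divT f n = f (suc n)

-- multiplicative inverse of a series g with g_0 = 2:
-- 1/g = (1/2) · 1/(1+w), w = (g-2)/2, 1/(1+w) = Σ_m (-1)^m w^m
inv2 : Series → Series
inv2 g n = ((+ 1) / 2) * compS (λ m → (- 1ℚ) ^ℚ m) w n
  where
  w : Series
  w zero = 0ℚ
  w (suc i) = g (suc i) * ((+ 1) / 2)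

eλPlus1 : (λ' : ℚ) → .{{NonZero λ'}} → Series
eλPlus1 λ' zero = eλ λ' 0 + 1ℚ
eλPlus1 λ' (suc n) = eλ λ' (suc n)

-- generating function  l_{k,λ}(1-e_λ(-2t)) / (t (e_λ(t)+1)) · e_λ^x(t)
polyEulerGF : (λ' : ℚ) → .{{NonZero λ'}} → ℤ → ℚ → Series
polyEulerGF λ' k x = (divT (polylogPart λ' k) ⋆ inv2 (eλPlus1 λ')) ⋆ eλx λ' x

polyEuler : (λ' : ℚ) → .{{NonZero λ'}} → ℤ → ℕ → ℚ → ℚ
polyEuler λ' k n x = factℚ n * polyEulerGF λ' k x n

polyEulerNum : (λ' : ℚ) → .{{NonZero λ'}} → ℤ → ℕ → ℚ
polyEulerNum λ' k n = polyEuler λ' k n 0ℚ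

eλMinus1 : (λ' : ℚ) → .{{NonZero λ'}} → Series
eλMinus1 λ' zero = eλ λ' 0 - 1ℚ
eλMinus1 λ' (suc n) = eλ λ' (suc n)

-- degenerate Stirling numbers of the second kind:
-- (1/m!) (e_λ(t)-1)^m = Σ_l S_{2,λ}(l,m) t^l / l!
stirling2λ : (λ' : ℚ) → .{{NonZero λ'}} → ℕ → ℕ → ℚ
stirling2λ λ' l m = factℚ l * invFact m * powS (eλMinus1 λ') m l

binomℚ : ℕ → ℕ → ℚ
binomℚ n l = ℕ→ℚ (n C l)

{-# OPTIONS --safe #-}
module Submission where

-- Let 𝔻 = (1 + λt) d/dt and u = e_λ(t) - 1. Since 𝔻 e_λ^x = x e_λ^x, the series
-- e_λ^x is the eigenfunction of 𝔻 with eigenvalue x and constant term 1; such an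
-- eigenfunction is unique, its coefficients obeying (n+1) f_{n+1} = (x - nλ) f_n.
-- As 𝔻 is a derivation with 𝔻u = 1 + u, we get 𝔻 u^{m+1} = (m+1)(u^m + u^{m+1}),
-- and with (m+1) c_{m+1} = (x - m) c_m for c_m = (x)_m / m! the sum 𝔻 Σ_m c_m u^m
-- telescopes to x Σ_m c_m u^m. Hence e_λ^x = Σ_m (x)_m/m! (e_λ(t) - 1)^m, i.e.
-- l! [t^l] e_λ^x = Σ_m (x)_m S_{2,λ}(l,m). The theorem is the binomial convolution
-- of this with the generating function of the numbers E_{n,λ}^{(k)}, which is the
-- x-independent factor of the generating function because e_λ^0 = 1.

open import Data.Nat as ℕ using (ℕ; zero; suc; _∸_; _≤_; _<_; z≤n; s≤s; _!)
import Data.Nat.Properties as ℕP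
open import Data.Nat.Combinatorics using (_C_; nCk≡n!/k![n-k]!; k![n∸k]!∣n!)
open import Data.Nat.DivMod using (m/n*n≡m)
open import Data.Integer as ℤ using (ℤ; +_)
import Data.Integer.Properties as ℤP
open import Data.Integer.Tactic.RingSolver using (solve-∀)
open import Data.Rational as ℚ using (ℚ; 0ℚ; 1ℚ; _+_; _*_; _-_; 1/_; _/_; NonZero; toℚᵘ)
import Data.Rational.Properties as ℚP
import Data.Rational.Unnormalised as ℚᵘ
import Data.Rational.Unnormalised.Properties as ℚᵘP
open import Data.Rational.Solver using (module +-*-Solver)
open import Relation.Binary.PropositionalEquality

open import Defs

open +-*-Solver
open ≡-Reasoning

toℚᵘ-ℕ→ℚ : ∀ n → toℚᵘ (ℕ→ℚ n) ℚᵘ.≃ ℚᵘ.mkℚᵘ (+ n) 0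
toℚᵘ-ℕ→ℚ n = ℚP.toℚᵘ-fromℚᵘ (ℚᵘ.mkℚᵘ (+ n) 0)

ℕ→ℚ-+ : ∀ m n → ℕ→ℚ (m ℕ.+ n) ≡ ℕ→ℚ m + ℕ→ℚ n
ℕ→ℚ-+ m n = ℚP.toℚᵘ-injective (ℚᵘP.≃-trans (toℚᵘ-ℕ→ℚ (m ℕ.+ n))
  (ℚᵘP.≃-trans (ℚᵘ.*≡* (trans (cong (ℤ._* (+ 1 ℤ.* + 1)) (ℤP.pos-+ m n)) (ring (+ m) (+ n))))
  (ℚᵘP.≃-sym (ℚᵘP.≃-trans (ℚP.toℚᵘ-homo-+ (ℕ→ℚ m) (ℕ→ℚ n)) (ℚᵘP.+-cong (toℚᵘ-ℕ→ℚ m) (toℚᵘ-ℕ→ℚ n))))))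
  where
  ring : ∀ a b → (a ℤ.+ b) ℤ.* (+ 1 ℤ.* + 1) ≡ (a ℤ.* + 1 ℤ.+ b ℤ.* + 1) ℤ.* + 1
  ring = solve-∀

ℕ→ℚ-* : ∀ m n → ℕ→ℚ (m ℕ.* n) ≡ ℕ→ℚ m * ℕ→ℚ n
ℕ→ℚ-* m n = ℚP.toℚᵘ-injective (ℚᵘP.≃-trans (toℚᵘ-ℕ→ℚ (m ℕ.* n))
  (ℚᵘP.≃-trans (ℚᵘ.*≡* (trans (cong (ℤ._* (+ 1 ℤ.* + 1)) (ℤP.pos-* m n)) (ring (+ m) (+ n))))
  (ℚᵘP.≃-sym (ℚᵘP.≃-trans (ℚP.toℚᵘ-homo-* (ℕ→ℚ m) (ℕ→ℚ n)) (ℚᵘP.*-cong (toℚᵘ-ℕ→ℚ m) (toℚᵘ-ℕ→ℚ n))))))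
  where
  ring : ∀ a b → (a ℤ.* b) ℤ.* (+ 1 ℤ.* + 1) ≡ (a ℤ.* b) ℤ.* + 1
  ring = solve-∀

1/[1+m]*[1+m]≡1 : ∀ m → ((+ 1) / suc m) * ℕ→ℚ (suc m) ≡ 1ℚ
1/[1+m]*[1+m]≡1 m = ℚP.toℚᵘ-injective (ℚᵘP.≃-trans (ℚP.toℚᵘ-homo-* ((+ 1) / suc m) (ℕ→ℚ (suc m)))
  (ℚᵘP.≃-trans (ℚᵘP.*-cong (ℚP.toℚᵘ-fromℚᵘ (ℚᵘ.mkℚᵘ (+ 1) m)) (toℚᵘ-ℕ→ℚ (suc m))) (ℚᵘ.*≡* (ring (+ suc m)))))
  where
  ring : ∀ a → (+ 1 ℤ.* a) ℤ.* + 1 ≡ + 1 ℤ.* (a ℤ.* + 1)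
  ring = solve-∀

*-cancelˡ-ℕ→ℚ-suc : ∀ m {a b} → ℕ→ℚ (suc m) * a ≡ ℕ→ℚ (suc m) * b → a ≡ b
*-cancelˡ-ℕ→ℚ-suc m {a} {b} eq = begin
  a                         ≡⟨ unscale a ⟨
  q * (ℕ→ℚ (suc m) * a)     ≡⟨ cong (q *_) eq ⟩
  q * (ℕ→ℚ (suc m) * b)     ≡⟨ unscale b ⟩
  b                         ∎
  where
  q = (+ 1) / suc m
  unscale : ∀ c → q * (ℕ→ℚ (suc m) * c) ≡ c
  unscale c = trans (sym (ℚP.*-assoc q _ c))
    (trans (cong (_* c) (1/[1+m]*[1+m]≡1 m)) (ℚP.*-identityˡ c))

factℚ≡ℕ→ℚ[n!] : ∀ n → factℚ n ≡ ℕ→ℚ (n !)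
factℚ≡ℕ→ℚ[n!] zero = refl
factℚ≡ℕ→ℚ[n!] (suc n) = begin
  factℚ n * ℕ→ℚ (suc n)      ≡⟨ cong (_* ℕ→ℚ (suc n)) (factℚ≡ℕ→ℚ[n!] n) ⟩
  ℕ→ℚ (n !) * ℕ→ℚ (suc n)    ≡⟨ ℚP.*-comm (ℕ→ℚ (n !)) _ ⟩
  ℕ→ℚ (suc n) * ℕ→ℚ (n !)    ≡⟨ ℕ→ℚ-* (suc n) (n !) ⟨
  ℕ→ℚ (suc n !)              ∎

binomℚ*factℚ*factℚ≡factℚ : ∀ {n l} → l ≤ n → binomℚ n l * factℚ l * factℚ (n ∸ l) ≡ factℚ n
binomℚ*factℚ*factℚ≡factℚ {n} {l} l≤n = begin
  binomℚ n l * factℚ l * factℚ (n ∸ l)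
    ≡⟨ cong₂ (λ a b → binomℚ n l * a * b) (factℚ≡ℕ→ℚ[n!] l) (factℚ≡ℕ→ℚ[n!] (n ∸ l)) ⟩
  ℕ→ℚ (n C l) * ℕ→ℚ (l !) * ℕ→ℚ ((n ∸ l) !)
    ≡⟨ cong (_* ℕ→ℚ ((n ∸ l) !)) (ℕ→ℚ-* (n C l) (l !)) ⟨
  ℕ→ℚ ((n C l) ℕ.* l !) * ℕ→ℚ ((n ∸ l) !)
    ≡⟨ ℕ→ℚ-* ((n C l) ℕ.* l !) ((n ∸ l) !) ⟨
  ℕ→ℚ ((n C l) ℕ.* l ! ℕ.* (n ∸ l) !)
    ≡⟨ cong ℕ→ℚ nCk*k!*[n∸k]!≡n! ⟩
  ℕ→ℚ (n !)
    ≡⟨ factℚ≡ℕ→ℚ[n!] n ⟨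
  factℚ n ∎
  where
  instance
    _ = ℕP._!*_!≢0 l (n ∸ l)
  nCk*k!*[n∸k]!≡n! : (n C l) ℕ.* l ! ℕ.* (n ∸ l) ! ≡ n !
  nCk*k!*[n∸k]!≡n! = begin
    (n C l) ℕ.* l ! ℕ.* (n ∸ l) !    ≡⟨ ℕP.*-assoc (n C l) (l !) _ ⟩
    (n C l) ℕ.* (l ! ℕ.* (n ∸ l) !)  ≡⟨ cong (ℕ._* (l ! ℕ.* (n ∸ l) !)) (nCk≡n!/k![n-k]! l≤n) ⟩
    n ! ℕ./ (l ! ℕ.* (n ∸ l) !) ℕ.* (l ! ℕ.* (n ∸ l) !)
      ≡⟨ m/n*n≡m (k![n∸k]!∣n! l≤n) ⟩
    n ! ∎

sumTo-cong : ∀ n {f g : ℕ → ℚ} → (∀ i → i ≤ n → f i ≡ g i) → sumTo n f ≡ sumTo n g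
sumTo-cong zero f≡g = f≡g 0 z≤n
sumTo-cong (suc n) f≡g =
  cong₂ _+_ (sumTo-cong n (λ i i≤n → f≡g i (ℕP.m≤n⇒m≤1+n i≤n))) (f≡g (suc n) ℕP.≤-refl)

sumTo-distrib-+ : ∀ n (f g : ℕ → ℚ) → sumTo n (λ i → f i + g i) ≡ sumTo n f + sumTo n g
sumTo-distrib-+ zero f g = refl
sumTo-distrib-+ (suc n) f g = begin
  sumTo n (λ i → f i + g i) + (f (suc n) + g (suc n))
    ≡⟨ cong (_+ (f (suc n) + g (suc n))) (sumTo-distrib-+ n f g) ⟩
  (sumTo n f + sumTo n g) + (f (suc n) + g (suc n))
    ≡⟨ solve 4 (λ a b c d → (a :+ b) :+ (c :+ d) := (a :+ c) :+ (b :+ d)) refl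
         (sumTo n f) (sumTo n g) (f (suc n)) (g (suc n)) ⟩
  sumTo (suc n) f + sumTo (suc n) g ∎

sumTo-*ˡ : ∀ n c (f : ℕ → ℚ) → sumTo n (λ i → c * f i) ≡ c * sumTo n f
sumTo-*ˡ zero c f = refl
sumTo-*ˡ (suc n) c f = trans (cong (_+ c * f (suc n)) (sumTo-*ˡ n c f))
  (sym (ℚP.*-distribˡ-+ c (sumTo n f) (f (suc n))))

sumTo-zero : ∀ n {f : ℕ → ℚ} → (∀ i → i ≤ n → f i ≡ 0ℚ) → sumTo n f ≡ 0ℚ
sumTo-zero zero f≡0 = f≡0 0 z≤n
sumTo-zero (suc n) f≡0 = cong₂ _+_ (sumTo-zero n (λ i i≤n → f≡0 i (ℕP.m≤n⇒m≤1+n i≤n))) (f≡0 (suc n) ℕP.≤-refl)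

sumTo-suc-head : ∀ n (f : ℕ → ℚ) → sumTo (suc n) f ≡ f 0 + sumTo n (λ i → f (suc i))
sumTo-suc-head zero f = refl
sumTo-suc-head (suc n) f =
  trans (cong (_+ f (suc (suc n))) (sumTo-suc-head n f)) (ℚP.+-assoc (f 0) _ _)

sumTo-reverse : ∀ n (f : ℕ → ℚ) → sumTo n f ≡ sumTo n (λ i → f (n ∸ i))
sumTo-reverse zero f = refl
sumTo-reverse (suc n) f = begin
  sumTo n f + f (suc n)                         ≡⟨ cong (_+ f (suc n)) (sumTo-reverse n f) ⟩
  sumTo n (λ i → f (n ∸ i)) + f (suc n)         ≡⟨ ℚP.+-comm _ (f (suc n)) ⟩
  f (suc n) + sumTo n (λ i → f (n ∸ i))         ≡⟨ sumTo-suc-head n (λ i → f (suc n ∸ i)) ⟨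
  sumTo (suc n) (λ i → f (suc n ∸ i))           ∎

*-sumTo-* : ∀ a n (f g : ℕ → ℚ) b → a * sumTo n (λ m → f m * g m) * b ≡ sumTo n (λ m → a * f m * g m * b)
*-sumTo-* a n f g b = begin
  a * sumTo n (λ m → f m * g m) * b
    ≡⟨ solve 3 (λ a s b → a :* s :* b := (a :* b) :* s) refl a (sumTo n (λ m → f m * g m)) b ⟩
  (a * b) * sumTo n (λ m → f m * g m)
    ≡⟨ sumTo-*ˡ n (a * b) _ ⟨
  sumTo n (λ m → (a * b) * (f m * g m))
    ≡⟨ sumTo-cong n (λ m _ → solve 4 (λ a b x y → (a :* b) :* (x :* y) := a :* x :* y :* b) refl a b (f m) (g m)) ⟩
  sumTo n (λ m → a * f m * g m * b) ∎

infixl 6 _⊕_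
infixr 7 _·_

_⊕_ : Series → Series → Series
(f ⊕ g) n = f n + g n

_·_ : ℚ → Series → Series
(c · f) n = c * f n

Σₛ : ℕ → (ℕ → Series) → Series
Σₛ K F N = sumTo K (λ m → F m N)

⋆-congˡ : ∀ {f f'} g → f ≗ f' → f ⋆ g ≗ f' ⋆ g
⋆-congˡ g f≗f' n = sumTo-cong n (λ i _ → cong (_* g (n ∸ i)) (f≗f' i))

⋆-congʳ : ∀ f {g g'} → g ≗ g' → f ⋆ g ≗ f ⋆ g'
⋆-congʳ f g≗g' n = sumTo-cong n (λ i _ → cong (f i *_) (g≗g' (n ∸ i)))

⋆-distribʳ-⊕ : ∀ f g h → (f ⊕ g) ⋆ h ≗ (f ⋆ h) ⊕ (g ⋆ h)
⋆-distribʳ-⊕ f g h n =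
  trans (sumTo-cong n (λ i _ → ℚP.*-distribʳ-+ (h (n ∸ i)) (f i) (g i))) (sumTo-distrib-+ n _ _)

⋆-distribˡ-⊕ : ∀ f g h → f ⋆ (g ⊕ h) ≗ (f ⋆ g) ⊕ (f ⋆ h)
⋆-distribˡ-⊕ f g h n =
  trans (sumTo-cong n (λ i _ → ℚP.*-distribˡ-+ (f i) (g (n ∸ i)) (h (n ∸ i)))) (sumTo-distrib-+ n _ _)

⋆-·ʳ : ∀ f c g → f ⋆ (c · g) ≗ c · (f ⋆ g)
⋆-·ʳ f c g n = trans (sumTo-cong n (λ i _ → reorder (f i) (g (n ∸ i)))) (sumTo-*ˡ n c _)
  where
  reorder : ∀ a b → a * (c * b) ≡ c * (a * b)
  reorder a b = solve 3 (λ a b c → a :* (c :* b) := c :* (a :* b)) refl a b c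

⋆-identityˡ : ∀ f → oneS ⋆ f ≗ f
⋆-identityˡ f zero = ℚP.*-identityˡ (f 0)
⋆-identityˡ f (suc n) = begin
  (oneS ⋆ f) (suc n)                                  ≡⟨ sumTo-suc-head n _ ⟩
  1ℚ * f (suc n) + sumTo n (λ i → 0ℚ * f (n ∸ i))     ≡⟨ cong₂ _+_ (ℚP.*-identityˡ (f (suc n)))
                                                           (sumTo-zero n (λ i _ → ℚP.*-zeroˡ (f (n ∸ i)))) ⟩
  f (suc n) + 0ℚ                                      ≡⟨ ℚP.+-identityʳ (f (suc n)) ⟩
  f (suc n)                                           ∎

⋆-comm : ∀ f g → f ⋆ g ≗ g ⋆ f
⋆-comm f g n = begin
  sumTo n (λ i → f i * g (n ∸ i))               ≡⟨ sumTo-reverse n _ ⟩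
  sumTo n (λ i → f (n ∸ i) * g (n ∸ (n ∸ i)))   ≡⟨ sumTo-cong n swap ⟩
  sumTo n (λ i → g i * f (n ∸ i))               ∎
  where
  swap : ∀ i → i ≤ n → f (n ∸ i) * g (n ∸ (n ∸ i)) ≡ g i * f (n ∸ i)
  swap i i≤n = trans (cong (λ j → f (n ∸ i) * g j) (ℕP.m∸[m∸n]≡n i≤n)) (ℚP.*-comm (f (n ∸ i)) (g i))

⋆-identityʳ : ∀ f → f ⋆ oneS ≗ f
⋆-identityʳ f n = trans (⋆-comm f oneS n) (⋆-identityˡ f n)

factℚ*⋆ : ∀ f g n → factℚ n * (f ⋆ g) n
                    ≡ sumTo n (λ l → binomℚ n l * (factℚ l * f l) * (factℚ (n ∸ l) * g (n ∸ l)))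
factℚ*⋆ f g n = trans (sym (sumTo-*ˡ n (factℚ n) _)) (sumTo-cong n term)
  where
  term : ∀ l → l ≤ n → factℚ n * (f l * g (n ∸ l))
                       ≡ binomℚ n l * (factℚ l * f l) * (factℚ (n ∸ l) * g (n ∸ l))
  term l l≤n = begin
    factℚ n * (f l * g (n ∸ l))
      ≡⟨ cong (_* (f l * g (n ∸ l))) (binomℚ*factℚ*factℚ≡factℚ l≤n) ⟨
    binomℚ n l * factℚ l * factℚ (n ∸ l) * (f l * g (n ∸ l))
      ≡⟨ solve 5 (λ b p q x y → b :* p :* q :* (x :* y) := b :* (p :* x) :* (q :* y)) refl
           (binomℚ n l) (factℚ l) (factℚ (n ∸ l)) (f l) (g (n ∸ l)) ⟩
    binomℚ n l * (factℚ l * f l) * (factℚ (n ∸ l) * g (n ∸ l)) ∎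

powS-vanish : ∀ u → u 0 ≡ 0ℚ → ∀ {m N} → N < m → powS u m N ≡ 0ℚ
powS-vanish u u₀≡0 {suc m} {N} N<1+m = sumTo-zero N term≡0
  where
  term≡0 : ∀ i → i ≤ N → u i * powS u m (N ∸ i) ≡ 0ℚ
  term≡0 zero _ = trans (cong (_* powS u m N) u₀≡0) (ℚP.*-zeroˡ (powS u m N))
  term≡0 (suc i) i<N = trans (cong (u (suc i) *_) (powS-vanish u u₀≡0 N∸[1+i]<m)) (ℚP.*-zeroʳ (u (suc i)))
    where
    N∸[1+i]<m : N ∸ suc i < m
    N∸[1+i]<m = ℕP.<-≤-trans (ℕP.∸-monoʳ-< (s≤s z≤n) i<N) (ℕP.≤-pred N<1+m)

⟨1+_t⟩*_ : ℚ → Series → Series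
(⟨1+ c t⟩* f) zero = f zero
(⟨1+ c t⟩* f) (suc n) = f (suc n) + c * f n

∂ : Series → Series
∂ f n = ℕ→ℚ (suc n) * f (suc n)

⟨1+t⟩*-cong : ∀ c {f g} → f ≗ g → ⟨1+ c t⟩* f ≗ ⟨1+ c t⟩* g
⟨1+t⟩*-cong c f≗g zero = f≗g 0
⟨1+t⟩*-cong c f≗g (suc n) = cong₂ (λ a b → a + c * b) (f≗g (suc n)) (f≗g n)

⟨1+t⟩*-⊕ : ∀ c f g → ⟨1+ c t⟩* (f ⊕ g) ≗ (⟨1+ c t⟩* f) ⊕ (⟨1+ c t⟩* g)
⟨1+t⟩*-⊕ c f g zero = refl
⟨1+t⟩*-⊕ c f g (suc n) =
  solve 5 (λ a b a' b' c → (a :+ b) :+ c :* (a' :+ b') := (a :+ c :* a') :+ (b :+ c :* b')) refl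
    (f (suc n)) (g (suc n)) (f n) (g n) c

⟨1+t⟩*-· : ∀ c a f → ⟨1+ c t⟩* (a · f) ≗ a · (⟨1+ c t⟩* f)
⟨1+t⟩*-· c a f zero = refl
⟨1+t⟩*-· c a f (suc n) =
  solve 4 (λ x y c a → a :* x :+ c :* (a :* y) := a :* (x :+ c :* y)) refl (f (suc n)) (f n) c a

⟨1+t⟩*-⋆ˡ : ∀ c f g → (⟨1+ c t⟩* f) ⋆ g ≗ ⟨1+ c t⟩* (f ⋆ g)
⟨1+t⟩*-⋆ˡ c f g zero = refl
⟨1+t⟩*-⋆ˡ c f g (suc n) = begin
  ((⟨1+ c t⟩* f) ⋆ g) (suc n)
    ≡⟨ sumTo-suc-head n _ ⟩
  f 0 * g (suc n) + sumTo n (λ i → (f (suc i) + c * f i) * g (n ∸ i))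
    ≡⟨ cong (_+_ (f 0 * g (suc n))) (trans (sumTo-cong n (λ i _ → expand (f (suc i)) (f i) (g (n ∸ i))))
                                         (sumTo-distrib-+ n _ _)) ⟩
  f 0 * g (suc n) + (sumTo n (λ i → f (suc i) * g (n ∸ i)) + sumTo n (λ i → c * (f i * g (n ∸ i))))
    ≡⟨ cong (λ z → f 0 * g (suc n) + (sumTo n (λ i → f (suc i) * g (n ∸ i)) + z)) (sumTo-*ˡ n c _) ⟩
  f 0 * g (suc n) + (sumTo n (λ i → f (suc i) * g (n ∸ i)) + c * (f ⋆ g) n)
    ≡⟨ ℚP.+-assoc (f 0 * g (suc n)) _ _ ⟨
  (f 0 * g (suc n) + sumTo n (λ i → f (suc i) * g (n ∸ i))) + c * (f ⋆ g) n
    ≡⟨ cong (_+ c * (f ⋆ g) n) (sumTo-suc-head n (λ i → f i * g (suc n ∸ i))) ⟨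
  (⟨1+ c t⟩* (f ⋆ g)) (suc n) ∎
  where
  expand : ∀ a b d → (a + c * b) * d ≡ a * d + c * (b * d)
  expand a b d = solve 4 (λ a b c d → (a :+ c :* b) :* d := a :* d :+ c :* (b :* d)) refl a b c d

⟨1+t⟩*-⋆ʳ : ∀ c f g → f ⋆ (⟨1+ c t⟩* g) ≗ ⟨1+ c t⟩* (f ⋆ g)
⟨1+t⟩*-⋆ʳ c f g n = begin
  (f ⋆ (⟨1+ c t⟩* g)) n     ≡⟨ ⋆-comm f (⟨1+ c t⟩* g) n ⟩
  ((⟨1+ c t⟩* g) ⋆ f) n     ≡⟨ ⟨1+t⟩*-⋆ˡ c g f n ⟩
  (⟨1+ c t⟩* (g ⋆ f)) n     ≡⟨ ⟨1+t⟩*-cong c (⋆-comm g f) n ⟩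
  (⟨1+ c t⟩* (f ⋆ g)) n     ∎

∂-⊕ : ∀ f g → ∂ (f ⊕ g) ≗ ∂ f ⊕ ∂ g
∂-⊕ f g n = ℚP.*-distribˡ-+ (ℕ→ℚ (suc n)) (f (suc n)) (g (suc n))

∂-· : ∀ a f → ∂ (a · f) ≗ a · ∂ f
∂-· a f n = solve 3 (λ k a x → k :* (a :* x) := a :* (k :* x)) refl (ℕ→ℚ (suc n)) a (f (suc n))

∂-⋆ : ∀ f g → ∂ (f ⋆ g) ≗ (∂ f ⋆ g) ⊕ (f ⋆ ∂ g)
∂-⋆ f g n = begin
  ℕ→ℚ (suc n) * sumTo (suc n) term
    ≡⟨ sumTo-*ˡ (suc n) (ℕ→ℚ (suc n)) term ⟨
  sumTo (suc n) (λ i → ℕ→ℚ (suc n) * term i)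
    ≡⟨ sumTo-cong (suc n) split ⟩
  sumTo (suc n) (λ i → ℕ→ℚ i * term i + ℕ→ℚ (suc n ∸ i) * term i)
    ≡⟨ sumTo-distrib-+ (suc n) _ _ ⟩
  sumTo (suc n) (λ i → ℕ→ℚ i * term i) + sumTo (suc n) (λ i → ℕ→ℚ (suc n ∸ i) * term i)
    ≡⟨ cong₂ _+_ differentiateLeft differentiateRight ⟩
  (∂ f ⋆ g) n + (f ⋆ ∂ g) n ∎
  where
  term : ℕ → ℚ
  term i = f i * g (suc n ∸ i)

  split : ∀ i → i ≤ suc n → ℕ→ℚ (suc n) * term i ≡ ℕ→ℚ i * term i + ℕ→ℚ (suc n ∸ i) * term i
  split i i≤1+n = begin
    ℕ→ℚ (suc n) * term i                           ≡⟨ cong (λ k → ℕ→ℚ k * term i) (ℕP.m+[n∸m]≡n i≤1+n) ⟨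
    ℕ→ℚ (i ℕ.+ (suc n ∸ i)) * term i               ≡⟨ cong (_* term i) (ℕ→ℚ-+ i (suc n ∸ i)) ⟩
    (ℕ→ℚ i + ℕ→ℚ (suc n ∸ i)) * term i             ≡⟨ ℚP.*-distribʳ-+ (term i) (ℕ→ℚ i) _ ⟩
    ℕ→ℚ i * term i + ℕ→ℚ (suc n ∸ i) * term i      ∎

  differentiateLeft : sumTo (suc n) (λ i → ℕ→ℚ i * term i) ≡ (∂ f ⋆ g) n
  differentiateLeft = begin
    sumTo (suc n) (λ i → ℕ→ℚ i * term i)
      ≡⟨ sumTo-suc-head n _ ⟩
    0ℚ * term 0 + sumTo n (λ i → ℕ→ℚ (suc i) * (f (suc i) * g (n ∸ i)))
      ≡⟨ cong₂ _+_ (ℚP.*-zeroˡ (term 0))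
           (sumTo-cong n (λ i _ → sym (ℚP.*-assoc (ℕ→ℚ (suc i)) (f (suc i)) (g (n ∸ i))))) ⟩
    0ℚ + (∂ f ⋆ g) n
      ≡⟨ ℚP.+-identityˡ _ ⟩
    (∂ f ⋆ g) n ∎

  differentiateRight : sumTo (suc n) (λ i → ℕ→ℚ (suc n ∸ i) * term i) ≡ (f ⋆ ∂ g) n
  differentiateRight = begin
    sumTo n (λ i → ℕ→ℚ (suc n ∸ i) * term i) + ℕ→ℚ (suc n ∸ suc n) * term (suc n)
      ≡⟨ cong₂ _+_ (sumTo-cong n inner) (trans (cong (λ k → ℕ→ℚ k * term (suc n)) (ℕP.n∸n≡0 n))
                                               (ℚP.*-zeroˡ (term (suc n)))) ⟩
    (f ⋆ ∂ g) n + 0ℚ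
      ≡⟨ ℚP.+-identityʳ _ ⟩
    (f ⋆ ∂ g) n ∎
    where
    inner : ∀ i → i ≤ n → ℕ→ℚ (suc n ∸ i) * term i ≡ f i * ∂ g (n ∸ i)
    inner i i≤n rewrite ℕP.+-∸-assoc 1 i≤n =
      solve 3 (λ k a b → k :* (a :* b) := a :* (k :* b)) refl (ℕ→ℚ (suc (n ∸ i))) (f i) (g (suc (n ∸ i)))

compS≡Σₛ-suc : ∀ u → u 0 ≡ 0ℚ → ∀ a N → compS a u N ≡ Σₛ (suc N) (λ m → a m · powS u m) N
compS≡Σₛ-suc u u₀≡0 a N = sym (begin
  compS a u N + a (suc N) * powS u (suc N) N   ≡⟨ cong (λ z → compS a u N + a (suc N) * z) (powS-vanish u u₀≡0 {suc N} ℕP.≤-refl) ⟩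
  compS a u N + a (suc N) * 0ℚ                 ≡⟨ cong (_+_ (compS a u N)) (ℚP.*-zeroʳ (a (suc N))) ⟩
  compS a u N + 0ℚ                             ≡⟨ ℚP.+-identityʳ (compS a u N) ⟩
  compS a u N                                  ∎)

binomialCoeff : ℚ → ℕ → ℚ
binomialCoeff x m = fallℚ x m * invFact m

binomialCoeff-suc : ∀ x m → binomialCoeff x (suc m) * ℕ→ℚ (suc m) ≡ binomialCoeff x m * (x - ℕ→ℚ m)
binomialCoeff-suc x m = begin
  (fallℚ x m * (x - ℕ→ℚ m)) * (invFact m * q) * ℕ→ℚ (suc m)
    ≡⟨ solve 5 (λ F a I q k → (F :* a) :* (I :* q) :* k := (F :* I) :* a :* (q :* k)) refl
         (fallℚ x m) (x - ℕ→ℚ m) (invFact m) q (ℕ→ℚ (suc m)) ⟩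
  binomialCoeff x m * (x - ℕ→ℚ m) * (q * ℕ→ℚ (suc m))
    ≡⟨ cong (binomialCoeff x m * (x - ℕ→ℚ m) *_) (1/[1+m]*[1+m]≡1 m) ⟩
  binomialCoeff x m * (x - ℕ→ℚ m) * 1ℚ
    ≡⟨ ℚP.*-identityʳ _ ⟩
  binomialCoeff x m * (x - ℕ→ℚ m) ∎
  where
  q = (+ 1) / suc m

module DegenerateDerivative (λ' : ℚ) where

  𝔻 : Series → Series
  𝔻 f = ⟨1+ λ' t⟩* ∂ f

  𝔻-local : ∀ f g N → f N ≡ g N → f (suc N) ≡ g (suc N) → 𝔻 f N ≡ 𝔻 g N
  𝔻-local f g zero _ f₁≡g₁ = cong (ℕ→ℚ 1 *_) f₁≡g₁
  𝔻-local f g (suc N) f≡g f'≡g' =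
    cong₂ (λ a b → ℕ→ℚ (suc (suc N)) * a + λ' * (ℕ→ℚ (suc N) * b)) f'≡g' f≡g

  𝔻-⊕ : ∀ f g → 𝔻 (f ⊕ g) ≗ 𝔻 f ⊕ 𝔻 g
  𝔻-⊕ f g n = trans (⟨1+t⟩*-cong λ' (∂-⊕ f g) n) (⟨1+t⟩*-⊕ λ' (∂ f) (∂ g) n)

  𝔻-· : ∀ a f → 𝔻 (a · f) ≗ a · 𝔻 f
  𝔻-· a f n = trans (⟨1+t⟩*-cong λ' (∂-· a f) n) (⟨1+t⟩*-· λ' a (∂ f) n)

  𝔻-Σₛ : ∀ K F → 𝔻 (Σₛ K F) ≗ Σₛ K (λ m → 𝔻 (F m))
  𝔻-Σₛ zero F n = refl
  𝔻-Σₛ (suc K) F n = trans (𝔻-⊕ (Σₛ K F) (F (suc K)) n) (cong (_+ 𝔻 (F (suc K)) n) (𝔻-Σₛ K F n))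

  𝔻-⋆ : ∀ f g → 𝔻 (f ⋆ g) ≗ (𝔻 f ⋆ g) ⊕ (f ⋆ 𝔻 g)
  𝔻-⋆ f g n = begin
    𝔻 (f ⋆ g) n
      ≡⟨ ⟨1+t⟩*-cong λ' (∂-⋆ f g) n ⟩
    (⟨1+ λ' t⟩* ((∂ f ⋆ g) ⊕ (f ⋆ ∂ g))) n
      ≡⟨ ⟨1+t⟩*-⊕ λ' (∂ f ⋆ g) (f ⋆ ∂ g) n ⟩
    (⟨1+ λ' t⟩* (∂ f ⋆ g)) n + (⟨1+ λ' t⟩* (f ⋆ ∂ g)) n
      ≡⟨ cong₂ _+_ (⟨1+t⟩*-⋆ˡ λ' (∂ f) g n) (⟨1+t⟩*-⋆ʳ λ' f (∂ g) n) ⟨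
    (𝔻 f ⋆ g) n + (f ⋆ 𝔻 g) n ∎

  𝔻-oneS : 𝔻 oneS ≗ 0ℚ · oneS
  𝔻-oneS zero = refl
  𝔻-oneS (suc n) = solve 3 (λ a b l → a :* con 0ℚ :+ l :* (b :* con 0ℚ) := con 0ℚ :* con 0ℚ) refl
    (ℕ→ℚ (suc (suc n))) (ℕ→ℚ (suc n)) λ'

  eigen⇒recurrence : ∀ {x f} → 𝔻 f ≗ x · f →
                     ∀ n → ℕ→ℚ (suc n) * f (suc n) ≡ f n * (x - ℕ→ℚ n * λ')
  eigen⇒recurrence {x} {f} 𝔻f≗xf zero = trans (𝔻f≗xf 0)
    (solve 3 (λ x a l → x :* a := a :* (x :- con 0ℚ :* l)) refl x (f 0) λ')
  eigen⇒recurrence {x} {f} 𝔻f≗xf (suc n) = begin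
    a                  ≡⟨ solve 2 (λ a b → a := (a :+ b) :- b) refl a b ⟩
    (a + b) - b        ≡⟨ cong (_- b) (𝔻f≗xf (suc n)) ⟩
    x * f (suc n) - b  ≡⟨ solve 4 (λ x y l k → x :* y :- l :* (k :* y) := y :* (x :- k :* l)) refl
                            x (f (suc n)) λ' (ℕ→ℚ (suc n)) ⟩
    f (suc n) * (x - ℕ→ℚ (suc n) * λ') ∎
    where
    a = ℕ→ℚ (suc (suc n)) * f (suc (suc n))
    b = λ' * (ℕ→ℚ (suc n) * f (suc n))

  recurrence⇒eigen : ∀ {x f} → (∀ n → ℕ→ℚ (suc n) * f (suc n) ≡ f n * (x - ℕ→ℚ n * λ')) →
                     𝔻 f ≗ x · f
  recurrence⇒eigen {x} {f} rec zero = trans (rec 0)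
    (solve 3 (λ x a l → a :* (x :- con 0ℚ :* l) := x :* a) refl x (f 0) λ')
  recurrence⇒eigen {x} {f} rec (suc n) = begin
    ℕ→ℚ (suc (suc n)) * f (suc (suc n)) + λ' * (ℕ→ℚ (suc n) * f (suc n))
      ≡⟨ cong (_+ λ' * (ℕ→ℚ (suc n) * f (suc n))) (rec (suc n)) ⟩
    f (suc n) * (x - ℕ→ℚ (suc n) * λ') + λ' * (ℕ→ℚ (suc n) * f (suc n))
      ≡⟨ solve 4 (λ y x k l → y :* (x :- k :* l) :+ l :* (k :* y) := x :* y) refl
           (f (suc n)) x (ℕ→ℚ (suc n)) λ' ⟩
    x * f (suc n) ∎

  eigen-unique : ∀ {x f g} → 𝔻 f ≗ x · f → 𝔻 g ≗ x · g → f 0 ≡ g 0 → f ≗ g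
  eigen-unique 𝔻f 𝔻g f₀≡g₀ zero = f₀≡g₀
  eigen-unique {x} {f} {g} 𝔻f 𝔻g f₀≡g₀ (suc n) = *-cancelˡ-ℕ→ℚ-suc n (begin
    ℕ→ℚ (suc n) * f (suc n)    ≡⟨ eigen⇒recurrence {x} {f} 𝔻f n ⟩
    f n * (x - ℕ→ℚ n * λ')     ≡⟨ cong (_* (x - ℕ→ℚ n * λ')) (eigen-unique {x} {f} {g} 𝔻f 𝔻g f₀≡g₀ n) ⟩
    g n * (x - ℕ→ℚ n * λ')     ≡⟨ eigen⇒recurrence {x} {g} 𝔻g n ⟨
    ℕ→ℚ (suc n) * g (suc n)    ∎)

  module _ {u : Series} (𝔻u≗1+u : 𝔻 u ≗ oneS ⊕ u) where

    private
      P : ℕ → Series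
      P = powS u

    𝔻-powS-step : ∀ m → 𝔻 (P (suc m)) ≗ (P m ⊕ P (suc m)) ⊕ (u ⋆ 𝔻 (P m))
    𝔻-powS-step m n = begin
      𝔻 (u ⋆ P m) n                                      ≡⟨ 𝔻-⋆ u (P m) n ⟩
      (𝔻 u ⋆ P m) n + R                                  ≡⟨ cong (_+ R) (⋆-congˡ (P m) 𝔻u≗1+u n) ⟩
      ((oneS ⊕ u) ⋆ P m) n + R                           ≡⟨ cong (_+ R) (⋆-distribʳ-⊕ oneS u (P m) n) ⟩
      ((oneS ⋆ P m) n + P (suc m) n) + R                 ≡⟨ cong (λ z → (z + P (suc m) n) + R) (⋆-identityˡ (P m) n) ⟩
      (P m n + P (suc m) n) + R                          ∎
      where
      R = (u ⋆ 𝔻 (P m)) n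

    𝔻-powS : ∀ m → 𝔻 (P (suc m)) ≗ ℕ→ℚ (suc m) · (P m ⊕ P (suc m))
    𝔻-powS zero n = begin
      𝔻 (P 1) n                               ≡⟨ 𝔻-powS-step 0 n ⟩
      (P 0 ⊕ P 1) n + (u ⋆ 𝔻 oneS) n          ≡⟨ cong (_+_ ((P 0 ⊕ P 1) n)) (⋆-congʳ u 𝔻-oneS n) ⟩
      (P 0 ⊕ P 1) n + (u ⋆ (0ℚ · oneS)) n     ≡⟨ cong (_+_ ((P 0 ⊕ P 1) n)) (⋆-·ʳ u 0ℚ oneS n) ⟩
      (P 0 ⊕ P 1) n + 0ℚ * (u ⋆ oneS) n       ≡⟨ solve 2 (λ a b → a :+ con 0ℚ :* b := con 1ℚ :* a) refl
                                                   ((P 0 ⊕ P 1) n) ((u ⋆ oneS) n) ⟩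
      1ℚ * (P 0 ⊕ P 1) n                      ∎
    𝔻-powS (suc m) n = begin
      𝔻 (P (suc (suc m))) n
        ≡⟨ 𝔻-powS-step (suc m) n ⟩
      (A + B) + (u ⋆ 𝔻 (P (suc m))) n
        ≡⟨ cong (_+_ (A + B)) (⋆-congʳ u (𝔻-powS m) n) ⟩
      (A + B) + (u ⋆ (ℕ→ℚ (suc m) · (P m ⊕ P (suc m)))) n
        ≡⟨ cong (_+_ (A + B)) (trans (⋆-·ʳ u (ℕ→ℚ (suc m)) (P m ⊕ P (suc m)) n)
                                     (cong (ℕ→ℚ (suc m) *_) (⋆-distribˡ-⊕ u (P m) (P (suc m)) n))) ⟩
      (A + B) + ℕ→ℚ (suc m) * (A + B)
        ≡⟨ solve 2 (λ a k → a :+ k :* a := (con 1ℚ :+ k) :* a) refl (A + B) (ℕ→ℚ (suc m)) ⟩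
      (1ℚ + ℕ→ℚ (suc m)) * (A + B)
        ≡⟨ cong (_* (A + B)) (ℕ→ℚ-+ 1 (suc m)) ⟨
      ℕ→ℚ (suc (suc m)) * (A + B) ∎
      where
      A = P (suc m) n
      B = P (suc (suc m)) n

    Σₛ-binomial-𝔻-telescope :
      ∀ x K N → Σₛ K (λ m → binomialCoeff x m · 𝔻 (P m)) N
                ≡ x * Σₛ K (λ m → binomialCoeff x m · P m) N - (x - ℕ→ℚ K) * (binomialCoeff x K * P K N)
    Σₛ-binomial-𝔻-telescope x zero N = trans (cong (c 0 *_) (𝔻-oneS N))
      (solve 3 (λ c p x → c :* (con 0ℚ :* p) := x :* (c :* p) :- (x :- con 0ℚ) :* (c :* p)) refl
        (c 0) (oneS N) x)
      where c = binomialCoeff x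
    Σₛ-binomial-𝔻-telescope x (suc K) N = begin
      Σₛ K (λ m → c m · 𝔻 (P m)) N + c (suc K) * 𝔻 (P (suc K)) N
        ≡⟨ cong₂ _+_ (Σₛ-binomial-𝔻-telescope x K N) (cong (c (suc K) *_) (𝔻-powS K N)) ⟩
      (x * S - (x - k) * (c K * p)) + c (suc K) * (k' * (p + p'))
        ≡⟨ solve 8 (λ x S k cK p c' k' p' → (x :* S :- (x :- k) :* (cK :* p)) :+ c' :* (k' :* (p :+ p'))
                                         := (x :* S :- (x :- k) :* (cK :* p)) :+ (c' :* k') :* (p :+ p'))
             refl x S k (c K) p (c (suc K)) k' p' ⟩
      (x * S - (x - k) * (c K * p)) + (c (suc K) * k') * (p + p')
        ≡⟨ cong (λ z → (x * S - (x - k) * (c K * p)) + z * (p + p')) (binomialCoeff-suc x K) ⟩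
      (x * S - (x - k) * (c K * p)) + (c K * (x - k)) * (p + p')
        ≡⟨ solve 6 (λ x S k cK p p' → (x :* S :- (x :- k) :* (cK :* p)) :+ (cK :* (x :- k)) :* (p :+ p')
                                   := x :* S :+ (cK :* (x :- k)) :* p')
             refl x S k (c K) p p' ⟩
      x * S + (c K * (x - k)) * p'
        ≡⟨ cong (λ z → x * S + z * p') (binomialCoeff-suc x K) ⟨
      x * S + (c (suc K) * k') * p'
        ≡⟨ solve 5 (λ x S c' k' p' → x :* S :+ (c' :* k') :* p' := x :* (S :+ c' :* p') :- (x :- k') :* (c' :* p'))
             refl x S (c (suc K)) k' p' ⟩
      x * (S + c (suc K) * p') - (x - k') * (c (suc K) * p') ∎
      where
      c = binomialCoeff x
      S = Σₛ K (λ m → c m · P m) N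
      k = ℕ→ℚ K
      k' = ℕ→ℚ (suc K)
      p = P K N
      p' = P (suc K) N

    𝔻-binomialSeries : u 0 ≡ 0ℚ → ∀ x → 𝔻 (compS (binomialCoeff x) u) ≗ x · compS (binomialCoeff x) u
    𝔻-binomialSeries u₀≡0 x N = begin
      𝔻 (compS c u) N
        ≡⟨ 𝔻-local (compS c u) (Σₛ (suc N) (λ m → c m · P m)) N (compS≡Σₛ-suc u u₀≡0 c N) refl ⟩
      𝔻 (Σₛ (suc N) (λ m → c m · P m)) N
        ≡⟨ 𝔻-Σₛ (suc N) (λ m → c m · P m) N ⟩
      Σₛ (suc N) (λ m → 𝔻 (c m · P m)) N
        ≡⟨ sumTo-cong (suc N) (λ m _ → 𝔻-· (c m) (P m) N) ⟩
      Σₛ (suc N) (λ m → c m · 𝔻 (P m)) N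
        ≡⟨ Σₛ-binomial-𝔻-telescope x (suc N) N ⟩
      x * Σₛ (suc N) (λ m → c m · P m) N - (x - ℕ→ℚ (suc N)) * (c (suc N) * P (suc N) N)
        ≡⟨ cong₂ (λ a b → x * a - (x - ℕ→ℚ (suc N)) * (c (suc N) * b))
             (sym (compS≡Σₛ-suc u u₀≡0 c N)) (powS-vanish u u₀≡0 {suc N} ℕP.≤-refl) ⟩
      x * compS c u N - (x - ℕ→ℚ (suc N)) * (c (suc N) * 0ℚ)
        ≡⟨ solve 4 (λ x a y c → x :* a :- y :* (c :* con 0ℚ) := x :* a) refl
             x (compS c u N) (x - ℕ→ℚ (suc N)) (c (suc N)) ⟩
      x * compS c u N ∎
      where
      c = binomialCoeff x

module DegenerateExponential (λ' : ℚ) .{{_ : NonZero λ'}} where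

  open DegenerateDerivative λ'

  eλx-recurrence : ∀ x n → ℕ→ℚ (suc n) * eλx λ' x (suc n) ≡ eλx λ' x n * (x - ℕ→ℚ n * λ')
  eλx-recurrence x n = begin
    ℕ→ℚ (suc n) * ((fallℚ a n * (a - ℕ→ℚ n)) * (λ' ^ℚ n * λ') * (invFact n * q))
      ≡⟨ solve 8 (λ k F a m L I q l → k :* ((F :* (a :- m)) :* (L :* l) :* (I :* q))
                                    := (F :* L :* I) :* ((a :* l :- m :* l) :* (q :* k)))
           refl (ℕ→ℚ (suc n)) (fallℚ a n) a (ℕ→ℚ n) (λ' ^ℚ n) (invFact n) q λ' ⟩
    eλx λ' x n * ((a * λ' - ℕ→ℚ n * λ') * (q * ℕ→ℚ (suc n)))
      ≡⟨ cong₂ (λ v w → eλx λ' x n * ((v - ℕ→ℚ n * λ') * w)) x/λ*λ≡x (1/[1+m]*[1+m]≡1 n) ⟩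
    eλx λ' x n * ((x - ℕ→ℚ n * λ') * 1ℚ)
      ≡⟨ cong (eλx λ' x n *_) (ℚP.*-identityʳ (x - ℕ→ℚ n * λ')) ⟩
    eλx λ' x n * (x - ℕ→ℚ n * λ') ∎
    where
    a = x * 1/ λ'
    q = (+ 1) / suc n
    x/λ*λ≡x : a * λ' ≡ x
    x/λ*λ≡x = trans (ℚP.*-assoc x (1/ λ') λ') (trans (cong (x *_) (ℚP.*-inverseˡ λ')) (ℚP.*-identityʳ x))

  𝔻-eλx : ∀ x → 𝔻 (eλx λ' x) ≗ x · eλx λ' x
  𝔻-eλx x = recurrence⇒eigen {x} {eλx λ' x} (eλx-recurrence x)

  𝔻-eλMinus1 : 𝔻 (eλMinus1 λ') ≗ oneS ⊕ eλMinus1 λ'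
  𝔻-eλMinus1 n = begin
    𝔻 (eλMinus1 λ') n             ≡⟨ ⟨1+t⟩*-cong λ' (λ _ → refl) n ⟩
    𝔻 (eλ λ') n                   ≡⟨ 𝔻-eλx 1ℚ n ⟩
    1ℚ * eλ λ' n                  ≡⟨ split n ⟩
    (oneS ⊕ eλMinus1 λ') n        ∎
    where
    split : ∀ n → 1ℚ * eλ λ' n ≡ (oneS ⊕ eλMinus1 λ') n
    split zero = refl
    split (suc n) = solve 1 (λ e → con 1ℚ :* e := con 0ℚ :+ e) refl (eλ λ' (suc n))

  eλx-zero : eλx λ' 0ℚ ≗ oneS
  eλx-zero = eigen-unique {0ℚ} {eλx λ' 0ℚ} {oneS} (𝔻-eλx 0ℚ) 𝔻-oneS refl

  eλx≗binomialSeries : ∀ x → eλx λ' x ≗ compS (binomialCoeff x) (eλMinus1 λ')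
  eλx≗binomialSeries x = eigen-unique {x} {eλx λ' x} {compS (binomialCoeff x) (eλMinus1 λ')} (𝔻-eλx x) (𝔻-binomialSeries 𝔻-eλMinus1 refl x) refl

  sumTo-fallℚ*stirling2λ : ∀ x l → sumTo l (λ m → fallℚ x m * stirling2λ λ' l m) ≡ factℚ l * eλx λ' x l
  sumTo-fallℚ*stirling2λ x l = begin
    sumTo l (λ m → fallℚ x m * stirling2λ λ' l m)
      ≡⟨ sumTo-cong l (λ m _ → reorder (fallℚ x m) (invFact m) (powS (eλMinus1 λ') m l)) ⟩
    sumTo l (λ m → factℚ l * (binomialCoeff x m * powS (eλMinus1 λ') m l))
      ≡⟨ sumTo-*ˡ l (factℚ l) _ ⟩
    factℚ l * compS (binomialCoeff x) (eλMinus1 λ') l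
      ≡⟨ cong (factℚ l *_) (eλx≗binomialSeries x l) ⟨
    factℚ l * eλx λ' x l ∎
    where
    reorder : ∀ F I p → F * (factℚ l * I * p) ≡ factℚ l * (F * I * p)
    reorder F I p = solve 4 (λ F f I p → F :* (f :* I :* p) := f :* (F :* I :* p)) refl F (factℚ l) I p

polyEulerKernel : (λ' : ℚ) → .{{NonZero λ'}} → ℤ → Series
polyEulerKernel λ' k = divT (polylogPart λ' k) ⋆ inv2 (eλPlus1 λ')

polyEulerNum≡factℚ*polyEulerKernel : (λ' : ℚ) → .{{_ : NonZero λ'}} → ∀ k n →
                                     polyEulerNum λ' k n ≡ factℚ n * polyEulerKernel λ' k n
polyEulerNum≡factℚ*polyEulerKernel λ' k n = cong (factℚ n *_)
  (trans (⋆-congʳ H eλx-zero n) (⋆-identityʳ H n))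
  where
  open DegenerateExponential λ'
  H = polyEulerKernel λ' k

mainTheorem10 : (λ' : ℚ) → .{{_ : NonZero λ'}} → (k : ℤ) (n : ℕ) (x : ℚ) →
    polyEuler λ' k n x ≡
      sumTo n (λ l → sumTo l (λ m →
        binomℚ n l * fallℚ x m * stirling2λ λ' l m * polyEulerNum λ' k (n ∸ l)))
mainTheorem10 λ' k n x = begin
  factℚ n * (H ⋆ F) n
    ≡⟨ cong (factℚ n *_) (⋆-comm H F n) ⟩
  factℚ n * (F ⋆ H) n
    ≡⟨ factℚ*⋆ F H n ⟩
  sumTo n (λ l → binomℚ n l * (factℚ l * F l) * (factℚ (n ∸ l) * H (n ∸ l)))
    ≡⟨ sumTo-cong n (λ l _ → cong₂ (λ S E → binomℚ n l * S * E)
         (sumTo-fallℚ*stirling2λ x l) (polyEulerNum≡factℚ*polyEulerKernel λ' k (n ∸ l))) ⟨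
  sumTo n (λ l → binomℚ n l * sumTo l (λ m → fallℚ x m * stirling2λ λ' l m) * polyEulerNum λ' k (n ∸ l))
    ≡⟨ sumTo-cong n (λ l _ → *-sumTo-* (binomℚ n l) l (fallℚ x) (stirling2λ λ' l) (polyEulerNum λ' k (n ∸ l))) ⟩
  sumTo n (λ l → sumTo l (λ m →
    binomℚ n l * fallℚ x m * stirling2λ λ' l m * polyEulerNum λ' k (n ∸ l))) ∎
  where
  open DegenerateExponential λ'
  H = polyEulerKernel λ' k
  F = eλx λ' x
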